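{- Let $k\geq2$ be an integer, let $(a_i)_{i\geq0}$ be a strictly increasing sequence of positive integers, let $S_i=\{a_j\mid j\leq i\}$ and $S=\{a_j\mid j\geq0\}$. Assume $a_{i+1}>|\mathrm{per}(S_i)|$ for all $i$. Assume further that for every $i\ge0$: the Nim sequence of $S_i$ is purely periodic (i.e. $\mathrm{pref}(S_i)$ is empty), all its values are at most $k$, and $\mathrm{per}(S_{i+1})\neq\mathrm{per}(S_i)$. Then the limit $\lim_{i\to\infty}\mathrm{per}(S_i)$ exists and equals the Nim sequence of $S$.
   Context: For a set $S$ of positive integers, $\mathrm{SG}_S(n)=\mathrm{mex}\{\mathrm{SG}_S(n-s)\mid s\in S,s\le n\}$ and the Nim sequence of $S$ is $(\mathrm{SG}_S(n))_{n\ge0}$. For finite $S$, the Nim sequence has the form $uv^\omega$ with finite words $u,v$; taking $u$ and $v$ of minimal length, $u=\mathrm{pref}(S)$ is the prefix and $v=\mathrm{per}(S)$ is the period of $S$. (The hypothesis on each $i$ is exactly the condition that the greedy extension procedure, which on input $(S_i,a_{i+1},k)$ searches $j=a_{i+1},a_{i+1}+1,\dots$ for the first $j$ with $\mathrm{pref}(S_i\cup\{j\})$ empty, $\mathrm{per}(S_i\cup\{j\})\ne\mathrm{per}(S_i)$ and all period values $\le k$, returns $S_{i+1}$.) -}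

module Defs where

open import Data.Nat using (ℕ; zero; suc; _+_; _∸_; _<_; _≤_; _<ᵇ_; _≡ᵇ_; _%_)
open import Data.Bool using (Bool; true; false; if_then_else_; _∨_)
open import Data.List using (List; []; _∷_; length; upTo)
open import Data.Bool.ListAction using (any)
open import Data.Product using (Σ; _×_; ∃)
open import Relation.Binary.PropositionalEquality using (_≡_; _≢_)

-- n-th entry of a list (default 0 outside the range; only used in range)
nth : List ℕ → ℕ → ℕ
nth []       _       = 0
nth (x ∷ xs) zero    = x
nth (x ∷ xs) (suc n) = nth xs n

elemᵇ : ℕ → List ℕ → Bool
elemᵇ m []       = false
elemᵇ m (x ∷ xs) = (m ≡ᵇ x) ∨ elemᵇ m xs

-- mex of a finite set (given as a list): least m not in the list.
-- The mex is at most the length of the list, so searching that far suffices.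
mexAux : List ℕ → ℕ → ℕ → ℕ
mexAux xs zero    m = m
mexAux xs (suc f) m = if elemᵇ m xs then mexAux xs f (suc m) else m

mex : List ℕ → ℕ
mex xs = mexAux xs (length xs) 0

-- A set S of positive integers is given by its characteristic function mem.
-- Given hist = [SG(n-1), SG(n-2), ..., SG(0)], the option values
-- { SG(n-s) | s ∈ S, 1 ≤ s ≤ n } are collected by options.
optionsAux : (ℕ → Bool) → ℕ → List ℕ → List ℕ
optionsAux mem s []       = []
optionsAux mem s (x ∷ xs) =
  if mem s then x ∷ optionsAux mem (suc s) xs else optionsAux mem (suc s) xs

options : (ℕ → Bool) → List ℕ → List ℕ
options mem hist = optionsAux mem 1 hist

hist : (ℕ → Bool) → ℕ → List ℕ
hist mem zero    = []
hist mem (suc n) = mex (options mem (hist mem n)) ∷ hist mem n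

-- SG_S(n) = mex { SG_S(n-s) | s ∈ S, s ≤ n }; the Nim sequence of S is SG mem.
SG : (ℕ → Bool) → ℕ → ℕ
SG mem n = mex (options mem (hist mem n))

cyc : List ℕ → ℕ → ℕ
cyc []       m = 0
cyc (x ∷ xs) m = nth (x ∷ xs) (m % suc (length xs))

uvω : List ℕ → List ℕ → ℕ → ℕ
uvω u v n = if n <ᵇ length u then nth u n else cyc v (n ∸ length u)

IsUVω : (ℕ → ℕ) → List ℕ → List ℕ → Set
IsUVω w u v = (v ≢ []) × (∀ n → w n ≡ uvω u v n)

IsPrefPer : (ℕ → Bool) → List ℕ → List ℕ → Set
IsPrefPer mem u v =
  IsUVω (SG mem) u v ×
  (∀ u' v' → IsUVω (SG mem) u' v' → length u ≤ length u' × length v ≤ length v')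

memPrefixSet : (ℕ → ℕ) → ℕ → ℕ → Bool
memPrefixSet a i s = any (λ j → a j ≡ᵇ s) (upTo (suc i))

ConvergesTo : (ℕ → List ℕ) → (ℕ → ℕ) → Set
ConvergesTo ws w =
  ∀ n → ∃ λ I → ∀ i → I ≤ i → (n < length (ws i)) × (nth (ws i) n ≡ w n)

-- A period of S_{i+1} of length at most a_{i+1} would make the Nim sequence of S_{i+1} obey the
-- mex recursion of S_i as well: the two sets differ only in the move a_{i+1}, and by periodicity
-- every option value needed at position n is already realised at n mod |per|, by a move smaller
-- than a_{i+1}. Since the Nim sequence determines the period, per(S_{i+1}) = per(S_i) would follow.
-- Hence |per(S_{i+1})| > a_{i+1} ≥ i + 1, and per(S_{i+1}) begins with the Nim sequence of
-- S_{i+1}, whose first i + 1 values only see moves ≤ i and so coincide with those of S.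
module Submission where

open import Defs
open import Data.Nat using (ℕ; suc; _<_; _≤_)
open import Data.Bool using (Bool; T)
open import Data.List using (List; []; length)
open import Data.Product using (∃)
open import Function.Bundles using (_⇔_)
open import Relation.Binary.PropositionalEquality using (_≡_; _≢_)

open import Data.Bool using (true; false; _∨_; if_then_else_)
open import Data.Bool.ListAction using (any)
open import Data.Bool.Properties using (T-≡)
open import Data.Empty using (⊥-elim)
open import Data.Fin using (toℕ)
open import Data.Fin.Properties using (pigeonhole; toℕ<n)
open import Data.List using (_∷_; lookup; upTo)
open import Data.List.Membership.Propositional using (_∈_; _∉_; find; lose)
open import Data.List.Membership.Propositional.Properties using (∈-upTo⁺; ∈-upTo⁻)
open import Data.List.Relation.Unary.Any as Any using (here; there)
open import Data.List.Relation.Unary.Any.Properties using (any⁺; any⁻; lookup-index)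
open import Data.Nat using (zero; _+_; _*_; _∸_; _%_; _/_; _≡ᵇ_; NonZero; z≤n; s≤s; s≤s⁻¹; z<s)
open import Data.Nat.DivMod using (m≡m%n+[m/n]*n; [m+kn]%n≡m%n; m%n%n≡m%n; m%n<n; m%n≤m; m<n⇒m%n≡m)
open import Data.Nat.Induction using (<-rec)
open import Data.Nat.Properties
open import Data.Product using (_×_; _,_; proj₂)
open import Data.Sum using (_⊎_; inj₁; inj₂)
import Data.Sum as Sum
open import Function.Base using (_∘′_)
open import Function.Bundles using (mk⇔; module Equivalence)
open import Relation.Binary.Definitions using (tri<; tri≈; tri>)
open import Relation.Binary.PropositionalEquality
  using (_≗_; refl; sym; trans; cong; cong₂; subst; ≢-sym; module ≡-Reasoning)
open import Relation.Nullary using (¬_)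

open Equivalence using (to; from)

T-injective : ∀ {x y} → T x ⇔ T y → x ≡ y
T-injective {true}  {true}  _   = refl
T-injective {true}  {false} x⇔y = ⊥-elim (to x⇔y _)
T-injective {false} {true}  x⇔y = ⊥-elim (from x⇔y _)
T-injective {false} {false} _   = refl

elemᵇ≡any : ∀ m xs → elemᵇ m xs ≡ any (m ≡ᵇ_) xs
elemᵇ≡any m []       = refl
elemᵇ≡any m (x ∷ xs) = cong ((m ≡ᵇ x) ∨_) (elemᵇ≡any m xs)

T-elemᵇ : ∀ {m} xs → T (elemᵇ m xs) ⇔ m ∈ xs
T-elemᵇ {m} xs = mk⇔
  (λ m∈ᵇ → Any.map (≡ᵇ⇒≡ m _) (any⁻ (m ≡ᵇ_) xs (subst T (elemᵇ≡any m xs) m∈ᵇ)))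
  (λ m∈ → subst T (sym (elemᵇ≡any m xs)) (any⁺ (m ≡ᵇ_) (Any.map (≡⇒≡ᵇ m _) m∈)))

∈-below⇒≤length : ∀ {L} xs → (∀ {v} → v < L → v ∈ xs) → L ≤ length xs
∈-below⇒≤length {L} xs below = ≮⇒≥ λ length<L →
  let i , j , i<j , same-index = pigeonhole length<L (λ i → Any.index (below (toℕ<n i)))
  in <⇒≢ i<j (begin
       toℕ i                                   ≡⟨ lookup-index (below (toℕ<n i)) ⟩
       lookup xs (Any.index (below (toℕ<n i))) ≡⟨ cong (lookup xs) same-index ⟩
       lookup xs (Any.index (below (toℕ<n j))) ≡⟨ lookup-index (below (toℕ<n j)) ⟨
       toℕ j                                   ∎)
  where open ≡-Reasoning

extend-below : ∀ {xs m} → (∀ {v} → v < m → v ∈ xs) → m ∈ xs → ∀ {v} → v < suc m → v ∈ xs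
extend-below below m∈ v<1+m with m≤n⇒m<n∨m≡n (s≤s⁻¹ v<1+m)
... | inj₁ v<m  = below v<m
... | inj₂ refl = m∈

mexAux-below : ∀ xs f m → (∀ {v} → v < m → v ∈ xs) → ∀ {v} → v < mexAux xs f m → v ∈ xs
mexAux-below xs zero    m below = below
mexAux-below xs (suc f) m below with elemᵇ m xs in m∈ᵇ
... | true  = mexAux-below xs f (suc m) (extend-below below (to (T-elemᵇ xs) (from T-≡ m∈ᵇ)))
... | false = below

mexAux-stops : ∀ xs f m → mexAux xs f m ∉ xs ⊎ mexAux xs f m ≡ m + f
mexAux-stops xs zero    m = inj₂ (sym (+-identityʳ m))
mexAux-stops xs (suc f) m with elemᵇ m xs in m∈ᵇ
... | true  = Sum.map₂ (λ e → trans e (sym (+-suc m f))) (mexAux-stops xs f (suc m))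
... | false = inj₁ (λ m∈ → subst T m∈ᵇ (from (T-elemᵇ xs) m∈))

<mex⇒∈ : ∀ xs {v} → v < mex xs → v ∈ xs
<mex⇒∈ xs = mexAux-below xs (length xs) 0 (λ ())

-- The search in mex is cut off at length xs; by pigeonhole that value is never in xs.
mex∉ : ∀ xs → mex xs ∉ xs
mex∉ xs with mexAux-stops xs (length xs) 0
... | inj₁ mex∉xs  = mex∉xs
... | inj₂ mex≡len = λ mex∈ →
  <-irrefl mex≡len (∈-below⇒≤length xs (extend-below (<mex⇒∈ xs) mex∈))

mex-unique : ∀ xs {m} → m ∉ xs → (∀ {v} → v < m → v ∈ xs) → mex xs ≡ m
mex-unique xs {m} m∉ below with <-cmp (mex xs) m
... | tri< mex<m _ _ = ⊥-elim (mex∉ xs (below mex<m))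
... | tri≈ _ mex≡m _ = mex≡m
... | tri> _ _ m<mex = ⊥-elim (m∉ (<mex⇒∈ xs m<mex))

∈-optionsAux⁻ : ∀ mem s L {v} → v ∈ optionsAux mem s L →
                ∃ λ j → j < length L × T (mem (s + j)) × nth L j ≡ v
∈-optionsAux⁻ mem s (x ∷ L) v∈ with mem s in s∈ | v∈
... | true  | here refl = 0 , z<s , subst (T ∘′ mem) (sym (+-identityʳ s)) (from T-≡ s∈) , refl
... | true  | there v∈′ with j , j< , mj , e ← ∈-optionsAux⁻ mem (suc s) L v∈′ =
  suc j , s≤s j< , subst (T ∘′ mem) (sym (+-suc s j)) mj , e
... | false | v∈′ with j , j< , mj , e ← ∈-optionsAux⁻ mem (suc s) L v∈′ =
  suc j , s≤s j< , subst (T ∘′ mem) (sym (+-suc s j)) mj , e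

∈-optionsAux⁺ : ∀ mem s L {j} → j < length L → T (mem (s + j)) → nth L j ∈ optionsAux mem s L
∈-optionsAux⁺ mem s (x ∷ L) {zero} _ mj with mem s | subst (T ∘′ mem) (+-identityʳ s) mj
... | true  | _  = here refl
... | false | ()
∈-optionsAux⁺ mem s (x ∷ L) {suc j} (s≤s j<) mj with mem s
... | true  = there (∈-optionsAux⁺ mem (suc s) L j< (subst (T ∘′ mem) (+-suc s j) mj))
... | false = ∈-optionsAux⁺ mem (suc s) L j< (subst (T ∘′ mem) (+-suc s j) mj)

optionsAux-cong : ∀ {mem mem′} s L → (∀ {t} → t < s + length L → mem t ≡ mem′ t) →
                  optionsAux mem s L ≡ optionsAux mem′ s L
optionsAux-cong s []      _     = refl
optionsAux-cong s (x ∷ L) agree =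
  cong₂ (λ b o → if b then x ∷ o else o) (agree (m<m+n s z<s))
        (optionsAux-cong (suc s) L (λ {t} t< → agree (subst (t <_) (sym (+-suc s (length L))) t<)))

length-hist : ∀ mem n → length (hist mem n) ≡ n
length-hist mem zero    = refl
length-hist mem (suc n) = cong suc (length-hist mem n)

nth-hist : ∀ mem {n j} → j < n → nth (hist mem n) j ≡ SG mem (n ∸ suc j)
nth-hist mem {suc n} {zero}  _        = refl
nth-hist mem {suc n} {suc j} (s≤s j<) = nth-hist mem j<

mutual
  hist-cong : ∀ {mem mem′} n → (∀ {t} → t ≤ n → mem t ≡ mem′ t) → hist mem n ≡ hist mem′ n
  hist-cong zero    _     = refl
  hist-cong (suc n) agree = cong₂ _∷_ (SG-cong n (agree ∘′ m≤n⇒m≤1+n)) (hist-cong n (agree ∘′ m≤n⇒m≤1+n))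

  SG-cong : ∀ {mem mem′} n → (∀ {t} → t ≤ n → mem t ≡ mem′ t) → SG mem n ≡ SG mem′ n
  SG-cong {mem} {mem′} n agree = cong mex (begin
    options mem  (hist mem n)  ≡⟨ cong (options mem) (hist-cong n agree) ⟩
    options mem  (hist mem′ n) ≡⟨ optionsAux-cong 1 (hist mem′ n) (agree ∘′ below) ⟩
    options mem′ (hist mem′ n) ∎)
    where
    open ≡-Reasoning
    below : ∀ {t} → t < suc (length (hist mem′ n)) → t ≤ n
    below {t} t< = s≤s⁻¹ (subst (λ m → t < suc m) (length-hist mem′ n) t<)

OptionValue : (ℕ → Bool) → (ℕ → ℕ) → ℕ → ℕ → Set
OptionValue mem H n v = ∃ λ j → j < n × T (mem (suc j)) × H (n ∸ suc j) ≡ v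

record MexRecursive (mem : ℕ → Bool) (H : ℕ → ℕ) : Set where
  field
    avoids  : ∀ n → ¬ OptionValue mem H n (H n)
    reaches : ∀ n {v} → v < H n → OptionValue mem H n v

optionValue-cong : ∀ {mem G H n v} → (∀ {m} → m < n → G m ≡ H m) →
                   OptionValue mem G n v → OptionValue mem H n v
optionValue-cong G≡H (j , j<n , mj , e) = j , j<n , mj , trans (sym (G≡H (∸-monoʳ-< z<s j<n))) e

∈-options⇔ : ∀ mem n {v} → v ∈ options mem (hist mem n) ⇔ OptionValue mem (SG mem) n v
∈-options⇔ mem n {v} = mk⇔ option⇒value value⇒option
  where
  option⇒value : v ∈ options mem (hist mem n) → OptionValue mem (SG mem) n v
  option⇒value v∈ =
    let j , j<length , mj , nth≡v = ∈-optionsAux⁻ mem 1 (hist mem n) v∈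
        j<n = subst (j <_) (length-hist mem n) j<length
    in j , j<n , mj , trans (sym (nth-hist mem j<n)) nth≡v
  value⇒option : OptionValue mem (SG mem) n v → v ∈ options mem (hist mem n)
  value⇒option (j , j<n , mj , refl) =
    subst (_∈ options mem (hist mem n)) (nth-hist mem j<n)
      (∈-optionsAux⁺ mem 1 (hist mem n) (subst (j <_) (sym (length-hist mem n)) j<n) mj)

SG-mexRecursive : ∀ mem → MexRecursive mem (SG mem)
SG-mexRecursive mem = record
  { avoids  = λ n opt → mex∉ (options mem (hist mem n)) (from (∈-options⇔ mem n) opt)
  ; reaches = λ n v< → to (∈-options⇔ mem n) (<mex⇒∈ (options mem (hist mem n)) v<)
  }

mexRecursive⇒SG≗ : ∀ {mem H} → MexRecursive mem H → SG mem ≗ H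
mexRecursive⇒SG≗ {mem} {H} rec = <-rec (λ n → SG mem n ≡ H n) step
  where
  open MexRecursive rec
  step : ∀ n → (∀ {m} → m < n → SG mem m ≡ H m) → SG mem n ≡ H n
  step n SG≡H = mex-unique (options mem (hist mem n))
    (λ Hn∈ → avoids n (optionValue-cong {mem} SG≡H (to (∈-options⇔ mem n) Hn∈)))
    (λ v< → from (∈-options⇔ mem n) (optionValue-cong {mem} (sym ∘′ SG≡H) (reaches n v<)))

HasPeriod : (ℕ → ℕ) → (q : ℕ) → .{{NonZero q}} → Set
HasPeriod H q = ∀ n → H n ≡ H (n % q)

hasPeriod-∸ : ∀ {H} q .{{_ : NonZero q}} → HasPeriod H q →
              ∀ n {j} → j ≤ n % q → H (n ∸ j) ≡ H (n % q ∸ j)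
hasPeriod-∸ {H} q period n {j} j≤ = begin
  H (n ∸ j)                       ≡⟨ cong (λ m → H (m ∸ j)) (m≡m%n+[m/n]*n n q) ⟩
  H (n % q + n / q * q ∸ j)       ≡⟨ cong H (+-∸-comm (n / q * q) j≤) ⟩
  H (n % q ∸ j + n / q * q)       ≡⟨ period _ ⟩
  H ((n % q ∸ j + n / q * q) % q) ≡⟨ cong H ([m+kn]%n≡m%n (n % q ∸ j) (n / q) q) ⟩
  H ((n % q ∸ j) % q)             ≡⟨ period _ ⟨
  H (n % q ∸ j)                   ∎
  where open ≡-Reasoning

ExtendsAbove : ℕ → (ℕ → Bool) → (ℕ → Bool) → Set
ExtendsAbove A mem mem′ = (∀ {t} → T (mem t) → T (mem′ t)) × (∀ {t} → t < A → T (mem′ t) → T (mem t))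

-- Every option value v < H n is already realised at n % q by a move below q ≤ A, which lies in mem.
mexRecursive-restrict : ∀ {mem mem′ H A} q .{{_ : NonZero q}} → q ≤ A → ExtendsAbove A mem mem′ →
                        HasPeriod H q → MexRecursive mem′ H → MexRecursive mem H
mexRecursive-restrict {mem} {mem′} {H} q q≤A (mem⊆mem′ , mem′⊆mem) period rec′ = record
  { avoids  = λ n (j , j<n , mj , e) → avoids n (j , j<n , mem⊆mem′ mj , e)
  ; reaches = reaches-below
  }
  where
  open MexRecursive rec′
  reaches-below : ∀ n {v} → v < H n → OptionValue mem H n v
  reaches-below n v<Hn with j , j<n%q , mj , e ← reaches (n % q) (subst (_ <_) (period n) v<Hn) =
    j , <-≤-trans j<n%q (m%n≤m n q) ,
    mem′⊆mem (<-≤-trans (≤-<-trans j<n%q (m%n<n n q)) q≤A) mj ,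
    trans (hasPeriod-∸ q period n j<n%q) e

nth-ext : ∀ xs ys → length xs ≡ length ys → (∀ {n} → n < length xs → nth xs n ≡ nth ys n) → xs ≡ ys
nth-ext []       []       _        _     = refl
nth-ext (x ∷ xs) (y ∷ ys) same-len same =
  cong₂ _∷_ (same z<s) (nth-ext xs ys (suc-injective same-len) (λ n< → same (s≤s n<)))

isPrefPer-nth : ∀ {mem v} → IsPrefPer mem [] v → ∀ {n} → n < length v → nth v n ≡ SG mem n
isPrefPer-nth {v = x ∷ xs} ((_ , SG≡) , _) {n} n< =
  sym (trans (SG≡ n) (cong (nth (x ∷ xs)) (m<n⇒m%n≡m n<)))

isPrefPer-hasPeriod : ∀ {mem x xs} → IsPrefPer mem [] (x ∷ xs) → HasPeriod (SG mem) (length (x ∷ xs))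
isPrefPer-hasPeriod {x = x} {xs} ((_ , SG≡) , _) n =
  trans (SG≡ n) (trans (cong (nth (x ∷ xs)) (sym (m%n%n≡m%n n _))) (sym (SG≡ (n % _))))

isPrefPer-per-unique : ∀ {mem mem′ v v′} → IsPrefPer mem [] v → IsPrefPer mem′ [] v′ →
                       SG mem ≗ SG mem′ → v ≡ v′
isPrefPer-per-unique {v = v} {v′} P@((v≢[] , SG≡) , minimal) P′@((v′≢[] , SG≡′) , minimal′) SG≗ =
  nth-ext v v′ same-length λ {n} n< →
    trans (isPrefPer-nth P n<) (trans (SG≗ n) (sym (isPrefPer-nth P′ (subst (_ <_) same-length n<))))
  where
  same-length : length v ≡ length v′
  same-length = ≤-antisym
    (proj₂ (minimal  [] v′ (v′≢[] , λ n → trans (SG≗ n) (SG≡′ n))))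
    (proj₂ (minimal′ [] v  (v≢[]  , λ n → trans (sym (SG≗ n)) (SG≡ n))))

period-change⇒bound<length : ∀ {mem mem′ v v′ A} → ExtendsAbove A mem mem′ →
  IsPrefPer mem [] v → IsPrefPer mem′ [] v′ → v ≢ v′ → A < length v′
period-change⇒bound<length {v′ = []} _ _ ((v′≢[] , _) , _) _ = ⊥-elim (v′≢[] refl)
period-change⇒bound<length {v′ = x ∷ xs} extends P P′ v≢v′ = ≰⇒> λ length≤A →
  v≢v′ (isPrefPer-per-unique P P′ (mexRecursive⇒SG≗
    (mexRecursive-restrict (length (x ∷ xs)) length≤A extends
      (isPrefPer-hasPeriod P′) (SG-mexRecursive _))))

T-memPrefixSet : ∀ (a : ℕ → ℕ) i {t} → T (memPrefixSet a i t) ⇔ ∃ λ j → j ≤ i × a j ≡ t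
T-memPrefixSet a i {t} = mk⇔
  (λ t∈ → let j , j∈ , aj≡ᵇt = find (any⁻ _ (upTo (suc i)) t∈)
          in j , s≤s⁻¹ (∈-upTo⁻ j∈) , ≡ᵇ⇒≡ (a j) t aj≡ᵇt)
  (λ (j , j≤i , aj≡t) → any⁺ _ (lose (∈-upTo⁺ (s≤s j≤i)) (≡⇒≡ᵇ (a j) t aj≡t)))

memPrefixSet-extendsAbove : ∀ a i → ExtendsAbove (a (suc i)) (memPrefixSet a i) (memPrefixSet a (suc i))
memPrefixSet-extendsAbove a i = grows , no-new-below
  where
  grows : ∀ {t} → T (memPrefixSet a i t) → T (memPrefixSet a (suc i) t)
  grows t∈ = let j , j≤i , aj≡t = to (T-memPrefixSet a i) t∈
             in from (T-memPrefixSet a (suc i)) (j , m≤n⇒m≤1+n j≤i , aj≡t)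
  no-new-below : ∀ {t} → t < a (suc i) → T (memPrefixSet a (suc i) t) → T (memPrefixSet a i t)
  no-new-below t< t∈ with to (T-memPrefixSet a (suc i)) t∈
  ... | j , j≤1+i , aj≡t with m≤n⇒m<n∨m≡n j≤1+i
  ...   | inj₁ j<1+i = from (T-memPrefixSet a i) (j , s≤s⁻¹ j<1+i , aj≡t)
  ...   | inj₂ refl  = ⊥-elim (<-irrefl (sym aj≡t) t<)

memPrefixSet-≡ : ∀ (a : ℕ → ℕ) (memS : ℕ → Bool) {i t} → (∀ j → j ≤ a j) →
                 (∀ s → T (memS s) ⇔ ∃ λ j → a j ≡ s) → t ≤ i → memPrefixSet a i t ≡ memS t
memPrefixSet-≡ a memS {i} {t} j≤a[j] memS⇔ t≤i = T-injective (mk⇔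
  (λ t∈ → let j , _ , aj≡t = to (T-memPrefixSet a i) t∈ in from (memS⇔ t) (j , aj≡t))
  (λ t∈ → let j , aj≡t = to (memS⇔ t) t∈ in
     from (T-memPrefixSet a i) (j , ≤-trans (j≤a[j] j) (≤-trans (≤-reflexive aj≡t) t≤i) , aj≡t)))

strictlyIncreasing⇒inflationary : ∀ (a : ℕ → ℕ) → (∀ i → a i < a (suc i)) → ∀ j → j ≤ a j
strictlyIncreasing⇒inflationary a increasing zero    = z≤n
strictlyIncreasing⇒inflationary a increasing (suc j) =
  ≤-trans (s≤s (strictlyIncreasing⇒inflationary a increasing j)) (increasing j)

proposition5p1 : (k : ℕ) → 2 ≤ k →
    (a : ℕ → ℕ) → 0 < a 0 → (∀ i → a i < a (suc i)) →
    (memS : ℕ → Bool) → (∀ s → T (memS s) ⇔ ∃ λ j → a j ≡ s) →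
    (per : ℕ → List ℕ) →
    (∀ i → IsPrefPer (memPrefixSet a i) [] (per i)) →
    (∀ i n → SG (memPrefixSet a i) n ≤ k) →
    (∀ i → per (suc i) ≢ per i) →
    (∀ i → length (per i) < a (suc i)) →
    ConvergesTo per (SG memS)
-- Convergence needs neither the value bound k, nor a 0 > 0, nor |per(S_i)| < a_{i+1}.
proposition5p1 _ _ a _ increasing memS memS⇔ per isPrefPer _ per-changes _ n = suc n , converges
  where
  inflationary : ∀ j → j ≤ a j
  inflationary = strictlyIncreasing⇒inflationary a increasing

  S-agrees : ∀ {i t} → t ≤ i → memPrefixSet a i t ≡ memS t
  S-agrees = memPrefixSet-≡ a memS inflationary memS⇔

  per-long : ∀ i → a (suc i) < length (per (suc i))
  per-long i = period-change⇒bound<length (memPrefixSet-extendsAbove a i)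
    (isPrefPer i) (isPrefPer (suc i)) (≢-sym (per-changes i))

  converges : ∀ i → suc n ≤ i → n < length (per i) × nth (per i) n ≡ SG memS n
  converges (suc i) (s≤s n≤i) = n<length , (begin
    nth (per (suc i)) n           ≡⟨ isPrefPer-nth (isPrefPer (suc i)) n<length ⟩
    SG (memPrefixSet a (suc i)) n ≡⟨ SG-cong n (λ t≤n → S-agrees (≤-trans t≤n (m≤n⇒m≤1+n n≤i))) ⟩
    SG memS n                     ∎)
    where
    open ≡-Reasoning
    n<length : n < length (per (suc i))
    n<length = <-trans (≤-trans (s≤s n≤i) (inflationary (suc i))) (per-long i)
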